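{- A connected cograph $G$ has a dominating induced matching if and only if either $G$ is a super-star, or $G = G_1 \bowtie G_2$ is the join of a graph $G_1$ which is a disjoint union of edges and a stable set $G_2$.
   Context: A cograph is a graph with no induced $P_4$ (chordless path on 4 vertices). A dominating induced matching of $G=(V,E)$ is a set $M\subseteq E$ such that distinct edges of $M$ are disjoint and joined by no edge of $G$, and every edge of $E\setminus M$ shares an endpoint with an edge of $M$. $G$ is a super-star if $G$ has a universal vertex $u$ (adjacent to all other vertices) such that $G[V \setminus \{u\}]$ is the disjoint union of a star $K_{1,k}$ and a stable set. The join $G_1 \bowtie G_2$ of vertex-disjoint graphs is their disjoint union together with all edges between $V(G_1)$ and $V(G_2)$. A disjoint union of edges is a graph in which every vertex has degree exactly one. -}

module Defs where

open import Data.Nat using (ℕ)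
open import Data.Fin using (Fin)
open import Data.Bool using (Bool; true; false; T)
open import Data.Product using (Σ; ∃; ∃-syntax; _×_; _,_)
open import Data.Sum using (_⊎_)
open import Relation.Nullary using (¬_)
open import Relation.Binary.PropositionalEquality using (_≡_; _≢_)
open import Function.Bundles using (_⇔_)

record Graph (n : ℕ) : Set where
  field
    adj    : Fin n → Fin n → Bool
    sym    : ∀ u v → adj u v ≡ adj v u
    irrefl : ∀ u → adj u u ≡ false

module _ {n : ℕ} (G : Graph n) where
  open Graph G

  Adj : Fin n → Fin n → Set
  Adj u v = T (adj u v)

  data Reachable : Fin n → Fin n → Set where
    here : ∀ {u} → Reachable u u
    step : ∀ {u v w} → Adj u v → Reachable v w → Reachable u w

  Connected : Set
  Connected = ∀ u v → Reachable u v

  -- an induced P4  a - b - c - d  (chordless path on 4 vertices);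
  -- distinctness of a,b,c,d follows from these conditions and irreflexivity
  InducedP4 : Set
  InducedP4 = ∃[ a ] ∃[ b ] ∃[ c ] ∃[ d ]
    (Adj a b × Adj b c × Adj c d × ¬ Adj a c × ¬ Adj b d × ¬ Adj a d)

  Cograph : Set
  Cograph = ¬ InducedP4

  -- an edge set: a symmetric Bool-valued relation contained in adjacency
  -- (each unordered edge {u,v} is recorded in both orientations)
  record EdgeSet : Set where
    field
      mem    : Fin n → Fin n → Bool
      memSym : ∀ u v → mem u v ≡ mem v u
      sub    : ∀ u v → T (mem u v) → Adj u v

  open EdgeSet

  SameEdge : Fin n → Fin n → Fin n → Fin n → Set
  SameEdge u v x y = (u ≡ x × v ≡ y) ⊎ (u ≡ y × v ≡ x)

  IsInducedMatching : EdgeSet → Set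
  IsInducedMatching M = ∀ u v x y → T (mem M u v) → T (mem M x y) →
    ¬ SameEdge u v x y →
    (u ≢ x × u ≢ y × v ≢ x × v ≢ y) ×
    (¬ Adj u x × ¬ Adj u y × ¬ Adj v x × ¬ Adj v y)

  IsDominatingEdges : EdgeSet → Set
  IsDominatingEdges M = ∀ u v → Adj u v → ¬ T (mem M u v) →
    ∃[ w ] (T (mem M u w) ⊎ T (mem M v w))

  HasDIM : Set
  HasDIM = ∃[ M ] (IsInducedMatching M × IsDominatingEdges M)

  -- super-star: a universal vertex u such that G - u is the disjoint union of
  -- a star K_{1,k} (k ≥ 0) with centre c and leaf set L, and a stable set
  -- (the remaining vertices).
  SuperStar : Set
  SuperStar = Σ (Fin n) λ u → ((∀ v → v ≢ u → Adj u v) ×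
    ∃[ c ] Σ (Fin n → Bool) λ L → (c ≢ u × L c ≡ false × L u ≡ false ×
      (∀ x y → x ≢ u → y ≢ u →
        (Adj x y ⇔ ((x ≡ c × T (L y)) ⊎ (y ≡ c × T (L x)))))))

  -- G = G₁ ⋈ G₂ where G₁ (vertices with P true) is a disjoint union of edges
  -- (every vertex has exactly one neighbour inside G₁) and G₂ (vertices with
  -- P false) is a stable set.  Either side may be empty.
  JoinEdgesStable : Set
  JoinEdgesStable = Σ (Fin n → Bool) λ P →
    ((∀ x y → T (P x) → ¬ T (P y) → Adj x y) ×
     (∀ x y → ¬ T (P x) → ¬ T (P y) → ¬ Adj x y) ×
     (∀ x → T (P x) → ∃[ w ] (T (P w) × Adj x w ×
        (∀ w' → T (P w') → Adj x w' → w' ≡ w))))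

module Submission where

-- Sufficiency holds in every graph.  In a super-star with universal vertex u
-- and star centre c the single edge uc is a dominating induced matching: every
-- other edge contains u or c.  In a join G₁ ⋈ G₂ of a disjoint union of edges
-- G₁ with a stable set G₂ the edges of G₁ form one.
--
-- Necessity.  Let M be a dominating induced matching and call a vertex matched
-- if it lies on an edge of M.  Domination makes the unmatched vertices a
-- stable set; inducedness makes every neighbour of a matched vertex other than
-- its partner unmatched.  If every matched vertex sees every unmatched one, the
-- matched vertices induce a disjoint union of edges joined to a stable set.
-- Otherwise pick ab ∈ M and an unmatched y with a ≁ y.  In a connected cograph
-- any two distinct non-adjacent vertices have a common neighbour, and forbidding
-- induced P4s then forces M = {ab}, b universal, and every edge avoiding b to
-- join a to one of its other neighbours: G is a super-star with universal
-- vertex b and star centre a.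

open import Defs
open import Data.Nat using (ℕ)
open import Data.Fin using (Fin; _≟_)
open import Data.Fin.Properties using (any?)
open import Data.Bool using (Bool; false; T)
open import Data.Bool.Properties using (T?)
open import Data.Product using (∃; ∃-syntax; _×_; _,_; proj₁; proj₂; map₂)
open import Data.Sum using (_⊎_; inj₁; inj₂)
open import Data.Empty using (⊥; ⊥-elim)
open import Function using (_∘_)
open import Function.Bundles using (_⇔_; mk⇔; Equivalence)
open import Relation.Nullary using (¬_; Dec; yes; no)
open import Relation.Nullary.Decidable
  using (isYes; isYes≗does; dec-false; toWitness; fromWitness; decidable-stable; _×-dec_; _⊎-dec_; ¬?)
open import Relation.Binary.PropositionalEquality
  using (_≡_; _≢_; refl; sym; trans; subst)

isYes-false : ∀ {A : Set} (a? : Dec A) → ¬ A → isYes a? ≡ false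
isYes-false a? ¬a = trans (isYes≗does a?) (dec-false a? ¬a)

module _ {n : ℕ} (G : Graph n) where

  infix 4 _∼_
  _∼_ : Fin n → Fin n → Set
  u ∼ v = Adj G u v

  ∼? : ∀ u v → Dec (u ∼ v)
  ∼? u v = T? (Graph.adj G u v)

  ∼-sym : ∀ {u v} → u ∼ v → v ∼ u
  ∼-sym {u} {v} = subst T (Graph.sym G u v)

  ∼-irrefl : ∀ {u} → ¬ u ∼ u
  ∼-irrefl {u} = subst T (Graph.irrefl G u)

  ∼⇒≢ : ∀ {u v} → u ∼ v → u ≢ v
  ∼⇒≢ uv refl = ∼-irrefl uv

  -- In a cograph, two distinct non-adjacent vertices joined by a walk have a
  -- common neighbour: otherwise the walk contains an induced P4.
  commonNeighbour : Cograph G → ∀ {u w} → Reachable G u w → u ≢ w → ¬ u ∼ w →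
                    ∃[ x ] (u ∼ x × x ∼ w)
  commonNeighbour cg here u≢w _ = ⊥-elim (u≢w refl)
  commonNeighbour cg {u} {w} (step {v = v} u∼v walk) _ u≁w with v ≟ w
  ... | yes refl = ⊥-elim (u≁w u∼v)
  ... | no v≢w with ∼? v w
  ...   | yes v∼w = v , u∼v , v∼w
  ...   | no v≁w with commonNeighbour cg walk v≢w v≁w
  ...     | x , v∼x , x∼w with ∼? u x
  ...       | yes u∼x = x , u∼x , x∼w
  ...       | no u≁x = ⊥-elim (cg (u , v , x , w , u∼v , v∼x , x∼w , u≁x , v≁w , u≁w))

  decidedEdgeSet : (R : Fin n → Fin n → Set) → (∀ x y → Dec (R x y)) →
                   (∀ {x y} → R x y → R y x) → (∀ {x y} → R x y → x ∼ y) → EdgeSet G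
  decidedEdgeSet R R? R-sym R⇒∼ = record
    { mem    = λ x y → isYes (R? x y)
    ; memSym = mem-sym
    ; sub    = λ x y → R⇒∼ ∘ toWitness
    }
    where
    mem-sym : ∀ x y → isYes (R? x y) ≡ isYes (R? y x)
    mem-sym x y with R? x y | R? y x
    ... | yes _   | yes _   = refl
    ... | no _    | no _    = refl
    ... | yes xy  | no ¬yx  = ⊥-elim (¬yx (R-sym xy))
    ... | no ¬xy  | yes yx  = ⊥-elim (¬xy (R-sym yx))

  sameEdge-swap : ∀ {u v x y} → SameEdge G u v x y → SameEdge G u v y x
  sameEdge-swap (inj₁ (p , q)) = inj₂ (p , q)
  sameEdge-swap (inj₂ (p , q)) = inj₁ (p , q)

  sameEdge-both : ∀ {u v p q x y} → SameEdge G u v p q → SameEdge G u v x y →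
                  SameEdge G p q x y
  sameEdge-both (inj₁ (refl , refl)) (inj₁ (refl , refl)) = inj₁ (refl , refl)
  sameEdge-both (inj₁ (refl , refl)) (inj₂ (refl , refl)) = inj₂ (refl , refl)
  sameEdge-both (inj₂ (refl , refl)) (inj₁ (refl , refl)) = inj₂ (refl , refl)
  sameEdge-both (inj₂ (refl , refl)) (inj₂ (refl , refl)) = inj₁ (refl , refl)

  module SingleEdge {u v : Fin n} (u∼v : u ∼ v) where

    edge : EdgeSet G
    edge = decidedEdgeSet (SameEdge G u v)
      (λ x y → ((u ≟ x) ×-dec (v ≟ y)) ⊎-dec ((u ≟ y) ×-dec (v ≟ x)))
      sameEdge-swap
      λ { (inj₁ (refl , refl)) → u∼v ; (inj₂ (refl , refl)) → ∼-sym u∼v }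

    uv∈edge : T (EdgeSet.mem edge u v)
    uv∈edge = fromWitness (inj₁ (refl , refl))

    vu∈edge : T (EdgeSet.mem edge v u)
    vu∈edge = fromWitness (inj₂ (refl , refl))

    isInducedMatching : IsInducedMatching G edge
    isInducedMatching p q x y pq xy notSame =
      ⊥-elim (notSame (sameEdge-both (toWitness pq) (toWitness xy)))

    dominatesAt : ∀ {x} → x ≡ u ⊎ x ≡ v → ∃[ w ] T (EdgeSet.mem edge x w)
    dominatesAt (inj₁ refl) = v , uv∈edge
    dominatesAt (inj₂ refl) = u , vu∈edge

  -- In a super-star every edge contains the universal vertex or the centre,
  -- so that single edge is a dominating induced matching.
  superStar⇒DIM : SuperStar G → HasDIM G
  superStar⇒DIM (u , universal , c , _ , c≢u , _ , _ , star) =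
    edge , isInducedMatching , dominating
    where
    open SingleEdge (universal c c≢u)

    endpoint? : ∀ x → Dec (x ≡ u ⊎ x ≡ c)
    endpoint? x = (x ≟ u) ⊎-dec (x ≟ c)

    dominating : IsDominatingEdges G edge
    dominating x y x∼y _ with endpoint? x | endpoint? y
    ... | yes ex | _     = map₂ inj₁ (dominatesAt ex)
    ... | no _   | yes ey = map₂ inj₂ (dominatesAt ey)
    ... | no ¬ex | no ¬ey
      with Equivalence.to (star x y (¬ex ∘ inj₁) (¬ey ∘ inj₁)) x∼y
    ...   | inj₁ (x≡c , _) = ⊥-elim (¬ex (inj₂ x≡c))
    ...   | inj₂ (y≡c , _) = ⊥-elim (¬ey (inj₂ y≡c))

  -- In G₁ ⋈ G₂ the edges of G₁ are an induced matching (each vertex of G₁ has a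
  -- unique G₁-neighbour) and dominate, because G₂ is stable.
  join⇒DIM : JoinEdgesStable G → HasDIM G
  join⇒DIM (P , _ , stable , partnerIn) = M , inducedMatching , dominating
    where
    Within : Fin n → Fin n → Set
    Within x y = T (P x) × T (P y) × x ∼ y

    M : EdgeSet G
    M = decidedEdgeSet Within
      (λ x y → T? (P x) ×-dec T? (P y) ×-dec ∼? x y)
      (λ (px , py , x∼y) → py , px , ∼-sym x∼y)
      (proj₂ ∘ proj₂)

    unique : ∀ {z p q} → Within z p → Within z q → p ≡ q
    unique {z} {p} {q} (pz , pp , z∼p) (_ , pq , z∼q) =
      let (_ , _ , _ , only) = partnerIn z pz in trans (only p pp z∼p) (sym (only q pq z∼q))

    flip : ∀ {x y} → Within x y → Within y x
    flip (px , py , x∼y) = py , px , ∼-sym x∼y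

    inducedMatching : IsInducedMatching G M
    inducedMatching u v x y uv xy notSame =
      (u≢x , u≢y , v≢x , v≢y) ,
      (λ u∼x → v≢x (unique Wuv (pu , px , u∼x))) ,
      (λ u∼y → v≢y (unique Wuv (pu , py , u∼y))) ,
      (λ v∼x → u≢x (unique (flip Wuv) (pv , px , v∼x))) ,
      (λ v∼y → u≢y (unique (flip Wuv) (pv , py , v∼y)))
      where
      Wuv : Within u v
      Wuv = toWitness uv
      Wxy : Within x y
      Wxy = toWitness xy
      pu = proj₁ Wuv
      pv = proj₁ (proj₂ Wuv)
      px = proj₁ Wxy
      py = proj₁ (proj₂ Wxy)
      u≢x : u ≢ x
      u≢x refl = notSame (inj₁ (refl , unique Wuv Wxy))
      u≢y : u ≢ y
      u≢y refl = notSame (inj₂ (refl , unique Wuv (flip Wxy)))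
      v≢x : v ≢ x
      v≢x refl = notSame (inj₂ (unique (flip Wuv) Wxy , refl))
      v≢y : v ≢ y
      v≢y refl = notSame (inj₁ (unique (flip Wuv) (flip Wxy) , refl))

    covered : ∀ {x} → T (P x) → ∃[ w ] T (EdgeSet.mem M x w)
    covered {x} px = let (w , pw , x∼w , _) = partnerIn x px in w , fromWitness (px , pw , x∼w)

    meetsG₁ : ∀ {x y} → x ∼ y → T (P x) ⊎ T (P y)
    meetsG₁ {x} {y} x∼y with T? (P x) | T? (P y)
    ... | yes px | _      = inj₁ px
    ... | no _   | yes py = inj₂ py
    ... | no ¬px | no ¬py = ⊥-elim (stable x y ¬px ¬py x∼y)

    dominating : IsDominatingEdges G M
    dominating x y x∼y _ with meetsG₁ x∼y
    ... | inj₁ px = map₂ inj₁ (covered px)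
    ... | inj₂ py = map₂ inj₂ (covered py)

  module Matching (M : EdgeSet G) (induced : IsInducedMatching G M)
                  (dominating : IsDominatingEdges G M) where
    open EdgeSet M using (mem; memSym; sub)

    Paired : Fin n → Fin n → Set
    Paired x y = T (mem x y)

    Matched : Fin n → Set
    Matched x = ∃ (Paired x)

    matched? : ∀ x → Dec (Matched x)
    matched? x = any? (λ w → T? (mem x w))

    paired-sym : ∀ {x y} → Paired x y → Paired y x
    paired-sym {x} {y} = subst T (memSym x y)

    matched≢unmatched : ∀ {x y} → Matched x → ¬ Matched y → x ≢ y
    matched≢unmatched mx ¬my refl = ¬my mx

    unmatched-stable : ∀ {x y} → ¬ Matched x → ¬ Matched y → ¬ x ∼ y
    unmatched-stable {x} {y} ¬mx ¬my x∼y with T? (mem x y)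
    ... | yes xy  = ¬mx (y , xy)
    ... | no ¬xy with dominating x y x∼y ¬xy
    ...   | w , inj₁ xw = ¬mx (w , xw)
    ...   | w , inj₂ yw = ¬my (w , yw)

    offPartner-unmatched : ∀ {x x' z} → Paired x x' → x ∼ z → z ≢ x' → ¬ Matched z
    offPartner-unmatched {x} {x'} {z} xx' x∼z z≢x' (z' , zz') =
      proj₁ (proj₂ (induced x x' z z' xx' zz' notSame)) x∼z
      where
      notSame : ¬ SameEdge G x x' z z'
      notSame (inj₁ (x≡z , _)) = ∼⇒≢ x∼z x≡z
      notSame (inj₂ (_ , x'≡z)) = z≢x' (sym x'≡z)

    matchedNeighbour-partner : ∀ {x w z} → Paired x w → x ∼ z → Matched z → z ≡ w
    matchedNeighbour-partner {w = w} {z} xw x∼z mz with z ≟ w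
    ... | yes z≡w = z≡w
    ... | no z≢w = ⊥-elim (offPartner-unmatched xw x∼z z≢w mz)

    complete⇒join : (∀ x y → Matched x → ¬ Matched y → x ∼ y) → JoinEdgesStable G
    complete⇒join complete = P , join , stable , partnerIn
      where
      P : Fin n → Bool
      P x = isYes (matched? x)

      join : ∀ x y → T (P x) → ¬ T (P y) → x ∼ y
      join x y px ¬py = complete x y (toWitness px) (¬py ∘ fromWitness)

      stable : ∀ x y → ¬ T (P x) → ¬ T (P y) → ¬ x ∼ y
      stable x y ¬px ¬py = unmatched-stable (¬px ∘ fromWitness) (¬py ∘ fromWitness)

      partnerIn : ∀ x → T (P x) → ∃[ w ] (T (P w) × x ∼ w × (∀ w' → T (P w') → x ∼ w' → w' ≡ w))
      partnerIn x px =
        let (w , xw) = toWitness px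
        in w , fromWitness (x , paired-sym xw) , sub x w xw ,
           λ w' pw' x∼w' → matchedNeighbour-partner xw x∼w' (toWitness pw')

    -- Otherwise, in a connected cograph, a pair ab ∈ M and an unmatched y with
    -- a ≁ y make G a super-star with universal vertex b and centre a.
    module SuperStarCase (connected : Connected G) (cograph : Cograph G)
                         {a b y : Fin n} (ab : Paired a b) (¬my : ¬ Matched y)
                         (a≁y : ¬ a ∼ y) where

      a∼b : a ∼ b
      a∼b = sub a b ab

      ba : Paired b a
      ba = paired-sym ab

      distanceTwo : ∀ {u w} → u ≢ w → ¬ u ∼ w → ∃[ x ] (u ∼ x × x ∼ w)
      distanceTwo {u} {w} = commonNeighbour cograph (connected u w)

      b-neighbour-unmatched : ∀ {w} → b ∼ w → w ≢ a → ¬ Matched w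
      b-neighbour-unmatched = offPartner-unmatched ba

      -- The common neighbour of a and y can only be b.
      b∼y : b ∼ y
      b∼y with distanceTwo (matched≢unmatched (b , ab) ¬my) a≁y
      ... | w , a∼w , w∼y with w ≟ b
      ...   | yes refl = w∼y
      ...   | no w≢b = ⊥-elim (unmatched-stable (offPartner-unmatched ab a∼w w≢b) ¬my w∼y)

      -- M = {ab}: a further matched vertex v is non-adjacent to a and b, and a
      -- common neighbour w of b and v yields an induced P4 a-b-y-v or y-b-w-v.
      unmatched : ∀ {v} → v ≢ a → v ≢ b → ¬ Matched v
      unmatched {v} v≢a v≢b mv = inducedP4
        where
        b≁v : ¬ b ∼ v
        b≁v b∼v = b-neighbour-unmatched b∼v v≢a mv
        a≁v : ¬ a ∼ v
        a≁v a∼v = offPartner-unmatched ab a∼v v≢b mv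
        inducedP4 : ⊥
        inducedP4 with distanceTwo (v≢b ∘ sym) b≁v
        ... | w , b∼w , w∼v with w ≟ a
        ...   | yes refl = a≁v w∼v
        ...   | no w≢a with ∼? y v
        ...     | yes y∼v = cograph (a , b , y , v , a∼b , b∼y , y∼v , a≁y , b≁v , a≁v)
        ...     | no y≁v = cograph (y , b , w , v , ∼-sym b∼y , b∼w , w∼v ,
                                    unmatched-stable ¬my (b-neighbour-unmatched b∼w w≢a) ,
                                    b≁v , y≁v)

      -- b is universal: a non-neighbour v ∉ {a, b} of b would give the induced
      -- P4 y-b-a-v if a ∼ v, and otherwise an edge between two unmatched
      -- vertices through a common neighbour of b and v.
      b-universal : ∀ v → v ≢ b → b ∼ v
      b-universal v v≢b with v ≟ a
      ... | yes refl = ∼-sym a∼b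
      ... | no v≢a = decidable-stable (∼? b v) b∼v
        where
        ¬mv : ¬ Matched v
        ¬mv = unmatched v≢a v≢b
        b∼v : ¬ ¬ b ∼ v
        b∼v b≁v with ∼? a v
        ... | yes a∼v = cograph (y , b , a , v , ∼-sym b∼y , ∼-sym a∼b , a∼v ,
                                 a≁y ∘ ∼-sym , b≁v , unmatched-stable ¬my ¬mv)
        ... | no a≁v with distanceTwo (v≢b ∘ sym) b≁v
        ...   | w , b∼w , w∼v with w ≟ a
        ...     | yes refl = a≁v w∼v
        ...     | no w≢a = unmatched-stable (b-neighbour-unmatched b∼w w≢a) ¬mv w∼v

      Leaf : Fin n → Set
      Leaf v = a ∼ v × v ≢ b

      leaf? : ∀ v → Dec (Leaf v)
      leaf? v = ∼? a v ×-dec ¬? (v ≟ b)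

      leaves : Fin n → Bool
      leaves v = isYes (leaf? v)

      -- Away from b, every edge has an end matched (hence equal to a) and the
      -- other end is then a leaf.
      star : ∀ x z → x ≢ b → z ≢ b → (x ∼ z ⇔ ((x ≡ a × T (leaves z)) ⊎ (z ≡ a × T (leaves x))))
      star x z x≢b z≢b = mk⇔ to from
        where
        isA : ∀ {v} → v ≢ b → Matched v → v ≡ a
        isA {v} v≢b mv with v ≟ a
        ... | yes v≡a = v≡a
        ... | no v≢a = ⊥-elim (unmatched v≢a v≢b mv)

        to : x ∼ z → (x ≡ a × T (leaves z)) ⊎ (z ≡ a × T (leaves x))
        to x∼z with matched? x | matched? z
        ... | yes mx | _ =
          let x≡a = isA x≢b mx in inj₁ (x≡a , fromWitness (subst (_∼ z) x≡a x∼z , z≢b))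
        ... | no _ | yes mz =
          let z≡a = isA z≢b mz in inj₂ (z≡a , fromWitness (subst (_∼ x) z≡a (∼-sym x∼z) , x≢b))
        ... | no ¬mx | no ¬mz = ⊥-elim (unmatched-stable ¬mx ¬mz x∼z)

        from : (x ≡ a × T (leaves z)) ⊎ (z ≡ a × T (leaves x)) → x ∼ z
        from (inj₁ (refl , leaf)) = proj₁ (toWitness leaf)
        from (inj₂ (refl , leaf)) = ∼-sym (proj₁ (toWitness leaf))

      superStar : SuperStar G
      superStar = b , b-universal , a , leaves , ∼⇒≢ a∼b ,
                  isYes-false (leaf? a) (∼-irrefl ∘ proj₁) ,
                  isYes-false (leaf? b) (λ (_ , b≢b) → b≢b refl) ,
                  star

    classification : Connected G → Cograph G → SuperStar G ⊎ JoinEdgesStable G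
    classification connected cograph
      with any? (λ x → any? (λ y → matched? x ×-dec ¬? (matched? y) ×-dec ¬? (∼? x y)))
    ... | yes (a , y , (b , ab) , ¬my , a≁y) =
      inj₁ (SuperStarCase.superStar connected cograph ab ¬my a≁y)
    ... | no noMiss = inj₂ (complete⇒join complete)
      where
      complete : ∀ x y → Matched x → ¬ Matched y → x ∼ y
      complete x y mx ¬my = decidable-stable (∼? x y) (λ x≁y → noMiss (x , y , mx , ¬my , x≁y))

proposition2 : ∀ {n : ℕ} (G : Graph n) → Connected G → Cograph G →
    (HasDIM G ⇔ (SuperStar G ⊎ JoinEdgesStable G))
proposition2 G connected cograph = mk⇔ necessary sufficient
  where
  necessary : HasDIM G → SuperStar G ⊎ JoinEdgesStable G
  necessary (M , induced , dominating) =
    Matching.classification G M induced dominating connected cograph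

  sufficient : SuperStar G ⊎ JoinEdgesStable G → HasDIM G
  sufficient (inj₁ superStar) = superStar⇒DIM G superStar
  sufficient (inj₂ join)      = join⇒DIM G join
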